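{- For every integer $n\ge 1$, $\mathrm{a}_{101,210}(n)=\dfrac{3^{n-1}+1}{2}$.
   Context: An ascent of an integer word $x_1\cdots x_n$ is an index $j$ with $x_j<x_{j+1}$; $\mathrm{asc}(x_1\cdots x_n)$ denotes the number of ascents. An ascent sequence of length $n$ is a sequence $x_1\cdots x_n$ of nonnegative integers with $x_1=0$ and $x_i\le \mathrm{asc}(x_1\cdots x_{i-1})+1$ for all $1<i\le n$. A pattern is a word $p=p_1\cdots p_k$ of nonnegative integers whose set of values is $\{0,1,\dots,m\}$ for some $m$. A word $x_1\cdots x_n$ contains $p$ if there are indices $i_1<\cdots<i_k$ such that $x_{i_1}\cdots x_{i_k}$ is order-isomorphic to $p$ (i.e. for all $s,t$, $x_{i_s}<x_{i_t}$ iff $p_s<p_t$ and $x_{i_s}=x_{i_t}$ iff $p_s=p_t$); otherwise it avoids $p$. For a list $B$ of patterns, $\mathcal{A}_B(n)$ is the set of ascent sequences of length $n$ avoiding every pattern in $B$, and $\mathrm{a}_B(n)=|\mathcal{A}_B(n)|$. -}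

module Defs where

open import Data.Nat using (ℕ; zero; suc; _<_; _≤_; _+_; _<?_)
open import Data.List using (List; []; _∷_; length; lookup)
open import Data.Fin using (Fin; cast)
open import Data.Product using (Σ; _×_; ∃; _,_)
open import Relation.Binary.PropositionalEquality using (_≡_)
open import Relation.Nullary using (¬_; yes; no)
open import Function.Bundles using (_⇔_)
open import Data.List.Relation.Binary.Sublist.Propositional using (_⊆_)
open import Data.List.Relation.Unary.All using (All)

ascStep : ℕ → ℕ → ℕ
ascStep x y with x <? y
... | yes _ = 1
... | no _ = 0

asc : List ℕ → ℕ
asc [] = 0
asc (x ∷ []) = 0
asc (x ∷ y ∷ xs) = ascStep x y + asc (y ∷ xs)

open import Data.List using (_++_; [_])

data IsAscentSeq : List ℕ → Set where
  nil   : IsAscentSeq []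
  first : IsAscentSeq (0 ∷ [])
  snoc  : ∀ {w} x → IsAscentSeq w → ¬ (w ≡ []) → x ≤ suc (asc w) →
          IsAscentSeq (w ++ [ x ])

OrderIso : List ℕ → List ℕ → Set
OrderIso u p = Σ (length u ≡ length p) λ eq →
  ∀ (s t : Fin (length u)) →
    ((lookup u s < lookup u t) ⇔ (lookup p (cast eq s) < lookup p (cast eq t))) ×
    ((lookup u s ≡ lookup u t) ⇔ (lookup p (cast eq s) ≡ lookup p (cast eq t)))

Contains : List ℕ → List ℕ → Set
Contains x p = ∃ λ u → (u ⊆ x) × OrderIso u p

Avoids : List ℕ → List ℕ → Set
Avoids x p = ¬ Contains x p

InA : List (List ℕ) → ℕ → List ℕ → Set
InA B n x = IsAscentSeq x × (length x ≡ n) × All (Avoids x) B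

-- A letter y may be appended to a 101- and 210-avoiding word w exactly when it is safe:
-- no pair a > b occurring in this order in w has y = a (creating 101) or y < b
-- (creating 210). In an avoiding ascent sequence with maximum m every value up to m
-- occurs and m is the number of ascents, so the candidates are 0, …, m + 1, and the safe
-- ones are a set `lows` of letters below m, possibly m itself, and m + 1. Appending
-- y < m leaves lows = {y} and forbids m; appending m changes nothing; appending m + 1
-- adds m (if it was allowed) to lows. The sequences of length n + 1 are thus the leaves
-- at depth n of a generating tree labelled by (t = |lows|, e = [m allowed]), with
--   L(n+1, t, e) = t L(n, 1, 0) + e L(n, t, 1) + L(n, t + e, 1),
-- and induction gives 2 L(n, 1, 0) = 3^n + 1 and 2 L(n, t, 1) + t = (t + 1) 3^n + 1.
-- The root is (0, 1).

module Submission where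

open import Defs
open import Data.Bool using (Bool; true; false)
open import Data.Empty using (⊥-elim)
open import Data.Fin using (Fin; zero; suc; cast)
open import Data.List using (List; []; _∷_; [_]; _++_; length; lookup; map; concatMap)
open import Data.List.Properties
  using (++-assoc; ++-identityʳ; ∷-injectiveʳ; ∷ʳ-injective; length-++; length-map; map-++; map-∘; map-id)
open import Data.List.Membership.Propositional using (_∈_)
open import Data.List.Membership.Propositional.Properties using (∈-++⁺ˡ; ∈-++⁺ʳ; ∈-++⁻; ∈-map⁺; ∈-map⁻)
open import Data.List.Relation.Binary.Sublist.Propositional using (_⊆_; []; _∷_; _∷ʳ_; from∈; to∈; ⊆-refl)
open import Data.List.Relation.Binary.Sublist.Propositional.Properties
  using (++⁺; ++⁺ʳ; Any-resp-⊆; length-mono-≤)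
open import Data.List.Relation.Unary.All as All using (All; []; _∷_)
open import Data.List.Relation.Unary.All.Properties using (∷ʳ⁺)
open import Data.List.Relation.Unary.Any using (here; there)
open import Data.List.Relation.Unary.Unique.Propositional using (Unique; []; _∷_)
open import Data.List.Relation.Unary.Unique.Propositional.Properties
  using () renaming (++⁺ to Unique-++⁺; map⁺ to Unique-map⁺)
open import Data.Nat using (ℕ; zero; suc; _+_; _*_; _^_; _<_; _≤_; _<?_; _≤?_; z≤n; s≤s)
open import Data.Nat.ListAction using (sum)
open import Data.Nat.ListAction.Properties using (sum-++)
open import Data.Nat.Properties
open import Data.Nat.Tactic.RingSolver using (solve-∀)
open import Data.Product using (Σ; ∃; ∃-syntax; _×_; _,_; proj₁; proj₂)
open import Data.Sum using (_⊎_; inj₁; inj₂)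
open import Function using (_∘_)
open import Function.Bundles using (_⇔_; mk⇔; Equivalence)
open import Relation.Binary.Definitions using (tri<; tri≈; tri>)
open import Relation.Binary.PropositionalEquality
  using (_≡_; _≢_; refl; sym; trans; cong; cong₂; subst; module ≡-Reasoning)
open import Relation.Nullary using (¬_; yes; no)

-- Occurrences of 101 and 210

Has101 : List ℕ → Set
Has101 x = ∃[ a ] ∃[ b ] b < a × (a ∷ b ∷ a ∷ []) ⊆ x

Has210 : List ℕ → Set
Has210 x = ∃[ a ] ∃[ b ] ∃[ c ] b < a × c < b × (a ∷ b ∷ c ∷ []) ⊆ x

SameOrder : ℕ → ℕ → ℕ → ℕ → Set
SameOrder x y x′ y′ = ((x < y) ⇔ (x′ < y′)) × ((x ≡ y) ⇔ (x′ ≡ y′))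

private
  both : ∀ {A B : Set} → A → B → A ⇔ B
  both a b = mk⇔ (λ _ → b) (λ _ → a)

  neither : ∀ {A B : Set} → ¬ A → ¬ B → A ⇔ B
  neither ¬a ¬b = mk⇔ (λ a → ⊥-elim (¬a a)) (λ b → ⊥-elim (¬b b))

  irrefl : ∀ {a} → ¬ a < a
  irrefl = <-irrefl refl

Contains⇒Has101 : ∀ {x} → Contains x (1 ∷ 0 ∷ 1 ∷ []) → Has101 x
Contains⇒Has101 ((a ∷ b ∷ c ∷ []) , a∷b∷c⊆x , refl , iso) =
  a , b , Equivalence.from (proj₁ (iso (suc zero) zero)) (s≤s z≤n) ,
  subst (λ z → (a ∷ b ∷ z ∷ []) ⊆ _) (sym a≡c) a∷b∷c⊆x
  where
  a≡c : a ≡ c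
  a≡c = Equivalence.from (proj₂ (iso zero (suc (suc zero)))) refl

Contains⇒Has210 : ∀ {x} → Contains x (2 ∷ 1 ∷ 0 ∷ []) → Has210 x
Contains⇒Has210 ((a ∷ b ∷ c ∷ []) , a∷b∷c⊆x , refl , iso) =
  a , b , c , Equivalence.from (proj₁ (iso (suc zero) zero)) (s≤s (s≤s z≤n)) ,
  Equivalence.from (proj₁ (iso (suc (suc zero)) (suc zero))) (s≤s z≤n) , a∷b∷c⊆x

Has101⇒Contains : ∀ {x} → Has101 x → Contains x (1 ∷ 0 ∷ 1 ∷ [])
Has101⇒Contains (a , b , b<a , sub) = (a ∷ b ∷ a ∷ []) , sub , refl , iso
  where
  iso : ∀ (s t : Fin 3) → SameOrder (lookup (a ∷ b ∷ a ∷ []) s) (lookup (a ∷ b ∷ a ∷ []) t)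
          (lookup (1 ∷ 0 ∷ 1 ∷ []) (cast refl s)) (lookup (1 ∷ 0 ∷ 1 ∷ []) (cast refl t))
  iso zero             zero             = neither irrefl irrefl , both refl refl
  iso zero             (suc zero)       = neither (<-asym b<a) (λ ()) , neither (>⇒≢ b<a) (λ ())
  iso zero             (suc (suc zero)) = neither irrefl irrefl , both refl refl
  iso (suc zero)       zero             = both b<a (s≤s z≤n) , neither (<⇒≢ b<a) (λ ())
  iso (suc zero)       (suc zero)       = neither irrefl irrefl , both refl refl
  iso (suc zero)       (suc (suc zero)) = both b<a (s≤s z≤n) , neither (<⇒≢ b<a) (λ ())
  iso (suc (suc zero)) zero             = neither irrefl irrefl , both refl refl
  iso (suc (suc zero)) (suc zero)       = neither (<-asym b<a) (λ ()) , neither (>⇒≢ b<a) (λ ())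
  iso (suc (suc zero)) (suc (suc zero)) = neither irrefl irrefl , both refl refl

Has210⇒Contains : ∀ {x} → Has210 x → Contains x (2 ∷ 1 ∷ 0 ∷ [])
Has210⇒Contains (a , b , c , b<a , c<b , sub) = (a ∷ b ∷ c ∷ []) , sub , refl , iso
  where
  c<a : c < a
  c<a = <-trans c<b b<a
  iso : ∀ (s t : Fin 3) → SameOrder (lookup (a ∷ b ∷ c ∷ []) s) (lookup (a ∷ b ∷ c ∷ []) t)
          (lookup (2 ∷ 1 ∷ 0 ∷ []) (cast refl s)) (lookup (2 ∷ 1 ∷ 0 ∷ []) (cast refl t))
  iso zero             zero             = neither irrefl irrefl , both refl refl
  iso zero             (suc zero)       = neither (<-asym b<a) (<-asym (s≤s (s≤s z≤n))) , neither (>⇒≢ b<a) (λ ())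
  iso zero             (suc (suc zero)) = neither (<-asym c<a) (λ ()) , neither (>⇒≢ c<a) (λ ())
  iso (suc zero)       zero             = both b<a (s≤s (s≤s z≤n)) , neither (<⇒≢ b<a) (λ ())
  iso (suc zero)       (suc zero)       = neither irrefl irrefl , both refl refl
  iso (suc zero)       (suc (suc zero)) = neither (<-asym c<b) (λ ()) , neither (>⇒≢ c<b) (λ ())
  iso (suc (suc zero)) zero             = both c<a (s≤s z≤n) , neither (<⇒≢ c<a) (λ ())
  iso (suc (suc zero)) (suc zero)       = both c<b (s≤s z≤n) , neither (<⇒≢ c<b) (λ ())
  iso (suc (suc zero)) (suc (suc zero)) = neither irrefl irrefl , both refl refl

Has101-++ : ∀ {w} v → Has101 w → Has101 (w ++ v)
Has101-++ v (a , b , b<a , sub) = a , b , b<a , ++⁺ʳ v sub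

Has210-++ : ∀ {w} v → Has210 w → Has210 (w ++ v)
Has210-++ v (a , b , c , b<a , c<b , sub) = a , b , c , b<a , c<b , ++⁺ʳ v sub

⊆-snoc⁻ : ∀ {A : Set} {us : List A} ws y → us ⊆ ws ++ [ y ] →
          us ⊆ ws ⊎ ∃[ vs ] us ≡ vs ++ [ y ] × vs ⊆ ws
⊆-snoc⁻ []       y (.y ∷ʳ [])  = inj₁ []
⊆-snoc⁻ []       y (refl ∷ []) = inj₂ ([] , refl , [])
⊆-snoc⁻ (z ∷ ws) y (.z ∷ʳ p) with ⊆-snoc⁻ ws y p
... | inj₁ q              = inj₁ (z ∷ʳ q)
... | inj₂ (vs , eq , q)  = inj₂ (vs , eq , z ∷ʳ q)
⊆-snoc⁻ (z ∷ ws) y (refl ∷ p) with ⊆-snoc⁻ ws y p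
... | inj₁ q              = inj₁ (refl ∷ q)
... | inj₂ (vs , refl , q) = inj₂ (z ∷ vs , refl , refl ∷ q)

snoc-⊆-snoc⁻ : ∀ {A : Set} us {u} ws {y : A} → us ++ [ u ] ⊆ ws ++ [ y ] →
               us ++ [ u ] ⊆ ws ⊎ (u ≡ y × us ⊆ ws)
snoc-⊆-snoc⁻ us ws p with ⊆-snoc⁻ ws _ p
... | inj₁ q = inj₁ q
... | inj₂ (vs , eq , q) with ∷ʳ-injective us vs eq
...   | refl , refl = inj₂ (refl , q)

ascStep-≤ : ∀ {x y} → y ≤ x → ascStep x y ≡ 0
ascStep-≤ {x} {y} y≤x with x <? y
... | yes x<y = ⊥-elim (<⇒≱ x<y y≤x)
... | no _    = refl

ascStep-< : ∀ {x y} → x < y → ascStep x y ≡ 1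
ascStep-< {x} {y} x<y with x <? y
... | yes _   = refl
... | no x≮y = ⊥-elim (x≮y x<y)

asc-snoc : ∀ xs x y → asc ((xs ++ [ x ]) ++ [ y ]) ≡ asc (xs ++ [ x ]) + ascStep x y
asc-snoc []           x y = +-comm (ascStep x y) 0
asc-snoc (a ∷ [])     x y = trans (cong (ascStep a x +_) (asc-snoc [] x y))
                                  (sym (+-assoc (ascStep a x) 0 (ascStep x y)))
asc-snoc (a ∷ b ∷ xs) x y = trans (cong (ascStep a b +_) (asc-snoc (b ∷ xs) x y))
                                  (sym (+-assoc (ascStep a b) (asc (b ∷ xs ++ [ x ])) (ascStep x y)))

asc-snoc-≤ : ∀ xs {x y} → y ≤ x → asc ((xs ++ [ x ]) ++ [ y ]) ≡ asc (xs ++ [ x ])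
asc-snoc-≤ xs {x} {y} y≤x =
  trans (asc-snoc xs x y) (trans (cong (asc (xs ++ [ x ]) +_) (ascStep-≤ y≤x)) (+-identityʳ _))

asc-snoc-< : ∀ xs {x y} → x < y → asc ((xs ++ [ x ]) ++ [ y ]) ≡ suc (asc (xs ++ [ x ]))
asc-snoc-< xs {x} {y} x<y =
  trans (asc-snoc xs x y) (trans (cong (asc (xs ++ [ x ]) +_) (ascStep-< x<y)) (+-comm _ 1))

-- Appending a letter

Safe : List ℕ → ℕ → Set
Safe w y = ∀ {a b} → b < a → (a ∷ b ∷ []) ⊆ w → b ≤ y × y ≢ a

safe-snoc⁻ : ∀ {w x y} → Safe (w ++ [ x ]) y → Safe w y
safe-snoc⁻ safe b<a sub = safe b<a (++⁺ʳ _ sub)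

safe-snoc-max : ∀ {w x y} → All (_≤ x) w → Safe w y → Safe (w ++ [ x ]) y
safe-snoc-max {w} w≤x safe {a} b<a sub with snoc-⊆-snoc⁻ (a ∷ []) w sub
... | inj₁ sub′          = safe b<a sub′
... | inj₂ (refl , a∈w) = ⊥-elim (<⇒≱ b<a (All.lookup w≤x (to∈ a∈w)))

safe-above : ∀ {w m} → All (_≤ m) w → Safe w (suc m)
safe-above {m = m} w≤m {a} b<a sub =
  ≤-trans (<⇒≤ b<a) (m≤n⇒m≤1+n a≤m) , λ { refl → 1+n≰n a≤m }
  where
  a≤m : a ≤ m
  a≤m = All.lookup w≤m (Any-resp-⊆ sub (here refl))

Avoiding : List ℕ → Set
Avoiding w = ¬ Has101 w × ¬ Has210 w

Avoiding-++⁻ : ∀ {w} v → Avoiding (w ++ v) → Avoiding w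
Avoiding-++⁻ v (¬101 , ¬210) = (λ h → ¬101 (Has101-++ v h)) , (λ h → ¬210 (Has210-++ v h))

Avoiding-snoc : ∀ {w y} → Avoiding w → Safe w y → Avoiding (w ++ [ y ])
Avoiding-snoc {w} {y} (¬101 , ¬210) safe = no101 , no210
  where
  no101 : ¬ Has101 (w ++ [ y ])
  no101 (a , b , b<a , sub) with snoc-⊆-snoc⁻ (a ∷ b ∷ []) w sub
  ... | inj₁ sub′           = ¬101 (a , b , b<a , sub′)
  ... | inj₂ (a≡y , sub′) = proj₂ (safe b<a sub′) (sym a≡y)
  no210 : ¬ Has210 (w ++ [ y ])
  no210 (a , b , c , b<a , c<b , sub) with snoc-⊆-snoc⁻ (a ∷ b ∷ []) w sub
  ... | inj₁ sub′          = ¬210 (a , b , c , b<a , c<b , sub′)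
  ... | inj₂ (refl , sub′) = <⇒≱ c<b (proj₁ (safe b<a sub′))

Avoiding-snoc⇒Safe : ∀ {w y} → Avoiding (w ++ [ y ]) → Safe w y
Avoiding-snoc⇒Safe {y = y} (¬101 , ¬210) {a} {b} b<a sub = b≤y , y≢a
  where
  b≤y : b ≤ y
  b≤y with b ≤? y
  ... | yes b≤y = b≤y
  ... | no b≰y  = ⊥-elim (¬210 (a , b , y , b<a , ≰⇒> b≰y , ++⁺ sub ⊆-refl))
  y≢a : y ≢ a
  y≢a refl = ¬101 (y , b , b<a , ++⁺ sub ⊆-refl)

-- The generating tree

peakIf : Bool → ℕ → List ℕ
peakIf true  m = [ m ]
peakIf false m = []

∈-peakIf⁻ : ∀ {e m y} → y ∈ peakIf e m → y ≡ m
∈-peakIf⁻ {true} (here y≡m) = y≡m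

peakIf-unique : ∀ e m → Unique (peakIf e m)
peakIf-unique true  m = [] ∷ []
peakIf-unique false m = []

record State : Set where
  constructor state
  field
    peak        : ℕ
    lows        : List ℕ
    peakAllowed : Bool

open State

root : State
root = state 0 [] true

allowed : State → List ℕ
allowed (state m lows e) = lows ++ peakIf e m ++ [ suc m ]

data Step : State → ℕ → State → Set where
  descend : ∀ {m lows e y} → y ∈ lows → Step (state m lows e) y (state m [ y ] false)
  repeat  : ∀ {m lows} → Step (state m lows true) m (state m lows true)
  climb   : ∀ {m lows e} →
            Step (state m lows e) (suc m) (state (suc m) (lows ++ peakIf e m) true)

allowed-climb : ∀ m lows e →
  allowed (state (suc m) (lows ++ peakIf e m) true) ≡ allowed (state m lows e) ++ [ suc (suc m) ]
allowed-climb m lows e = begin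
  (lows ++ peakIf e m) ++ suc m ∷ suc (suc m) ∷ []        ≡⟨ ++-assoc lows (peakIf e m) _ ⟩
  lows ++ peakIf e m ++ suc m ∷ suc (suc m) ∷ []          ≡⟨ cong (lows ++_) (sym (++-assoc (peakIf e m) [ suc m ] _)) ⟩
  lows ++ (peakIf e m ++ [ suc m ]) ++ [ suc (suc m) ]    ≡⟨ sym (++-assoc lows _ _) ⟩
  (lows ++ peakIf e m ++ [ suc m ]) ++ [ suc (suc m) ]    ∎
  where open ≡-Reasoning

-- `flat` and `rising` say that the last letter of w lies between the lower allowed letters
-- and suc peak, without having to name that letter.
record Good (w : List ℕ) (s : State) : Set where
  field
    ascending    : IsAscentSeq w
    avoiding     : Avoiding w
    asc≡peak     : asc w ≡ peak s
    bounded      : All (_≤ peak s) w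
    onto         : ∀ {v} → v ≤ peak s → v ∈ w
    flat         : ∀ {y} → y ∈ lows s ++ peakIf (peakAllowed s) (peak s) → asc (w ++ [ y ]) ≡ asc w
    rising       : asc (w ++ [ suc (peak s) ]) ≡ suc (asc w)
    lows<peak    : All (_< peak s) (lows s)
    lows-unique  : Unique (lows s)
    allowed⇒safe : ∀ {y} → y ∈ allowed s → Safe w y
    safe⇒allowed : ∀ {y} → y ≤ suc (peak s) → Safe w y → y ∈ allowed s

  nonempty : w ≢ []
  nonempty refl with onto z≤n
  ... | ()

  ascending-snoc : ∀ {y} → y ≤ suc (peak s) → IsAscentSeq (w ++ [ y ])
  ascending-snoc y≤ = snoc _ ascending nonempty (subst (λ k → _ ≤ suc k) (sym asc≡peak) y≤)

  avoiding-snoc : ∀ {y} → y ∈ allowed s → Avoiding (w ++ [ y ])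
  avoiding-snoc y∈ = Avoiding-snoc avoiding (allowed⇒safe y∈)

  below-peak : ∀ {y} → y ∈ lows s ++ peakIf (peakAllowed s) (peak s) → y ≤ peak s
  below-peak {y} y∈ with ∈-++⁻ (lows s) y∈
  ... | inj₁ y∈lows = <⇒≤ (All.lookup lows<peak y∈lows)
  ... | inj₂ y∈peak = ≤-reflexive (∈-peakIf⁻ y∈peak)

good-root : Good (0 ∷ []) root
good-root = record
  { ascending    = first
  ; avoiding     = (λ (_ , _ , _ , sub) → too-long (length-mono-≤ sub))
                 , (λ (_ , _ , _ , _ , _ , sub) → too-long (length-mono-≤ sub))
  ; asc≡peak     = refl
  ; bounded      = z≤n ∷ []
  ; onto         = λ { z≤n → here refl }
  ; flat         = λ { (here refl) → refl }
  ; rising       = refl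
  ; lows<peak    = []
  ; lows-unique  = []
  ; allowed⇒safe = λ _ _ sub → ⊥-elim (too-long (length-mono-≤ sub))
  ; safe⇒allowed = λ { z≤n _ → here refl ; (s≤s z≤n) _ → there (here refl) }
  }
  where
  too-long : ∀ {k} → ¬ 2 + k ≤ 1
  too-long (s≤s ())

good-descend : ∀ {w m lows e y} → Good w (state m lows e) → y ∈ lows →
               Good (w ++ [ y ]) (state m [ y ] false)
good-descend {w} {m} {lows} {e} {y} g y∈lows = record
  { ascending    = ascending-snoc (m<n⇒m≤1+n y<m)
  ; avoiding     = avoiding-snoc (∈-++⁺ˡ y∈lows)
  ; asc≡peak     = trans (flat (∈-++⁺ˡ y∈lows)) asc≡peak
  ; bounded      = bounded′
  ; onto         = ∈-++⁺ˡ ∘ onto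
  ; flat         = λ { (here refl) → asc-snoc-≤ w ≤-refl }
  ; rising       = asc-snoc-< w (s≤s (<⇒≤ y<m))
  ; lows<peak    = y<m ∷ []
  ; lows-unique  = [] ∷ []
  ; allowed⇒safe = safe
  ; safe⇒allowed = complete
  }
  where
  open Good g
  y<m : y < m
  y<m = All.lookup lows<peak y∈lows
  bounded′ : All (_≤ m) (w ++ [ y ])
  bounded′ = ∷ʳ⁺ bounded (<⇒≤ y<m)
  safe : ∀ {z} → z ∈ y ∷ suc m ∷ [] → Safe (w ++ [ y ]) z
  safe (here refl) {a} b<a sub with snoc-⊆-snoc⁻ (a ∷ []) w sub
  ... | inj₁ sub′       = allowed⇒safe (∈-++⁺ˡ y∈lows) b<a sub′
  ... | inj₂ (refl , _) = ≤-refl , <⇒≢ b<a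
  safe (there (here refl)) = safe-above bounded′
  complete : ∀ {z} → z ≤ suc m → Safe (w ++ [ y ]) z → z ∈ y ∷ suc m ∷ []
  complete {z} z≤1+m safe′ with <-cmp z y
  ... | tri< z<y _ _ = ⊥-elim (<⇒≱ z<y (proj₁ (safe′ y<m (++⁺ (from∈ (onto ≤-refl)) ⊆-refl))))
  ... | tri≈ _ refl _ = here refl
  ... | tri> _ _ y<z with m≤n⇒m<n∨m≡n z≤1+m
  ...   | inj₁ z<1+m = ⊥-elim (proj₂ (safe′ y<z (++⁺ (from∈ (onto (≤-pred z<1+m))) ⊆-refl)) refl)
  ...   | inj₂ refl  = there (here refl)

good-repeat : ∀ {w m lows} → Good w (state m lows true) → Good (w ++ [ m ]) (state m lows true)
good-repeat {w} {m} {lows} g = record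
  { ascending    = ascending-snoc (n≤1+n m)
  ; avoiding     = avoiding-snoc (∈-++⁺ʳ lows (here refl))
  ; asc≡peak     = trans (flat (∈-++⁺ʳ lows (here refl))) asc≡peak
  ; bounded      = ∷ʳ⁺ bounded ≤-refl
  ; onto         = ∈-++⁺ˡ ∘ onto
  ; flat         = asc-snoc-≤ w ∘ below-peak
  ; rising       = asc-snoc-< w (n<1+n m)
  ; lows<peak    = lows<peak
  ; lows-unique  = lows-unique
  ; allowed⇒safe = safe-snoc-max bounded ∘ allowed⇒safe
  ; safe⇒allowed = λ z≤ → safe⇒allowed z≤ ∘ safe-snoc⁻
  }
  where open Good g

good-climb : ∀ {w m lows e} → Good w (state m lows e) →
             Good (w ++ [ suc m ]) (state (suc m) (lows ++ peakIf e m) true)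
good-climb {w} {m} {lows} {e} g = record
  { ascending    = ascending-snoc ≤-refl
  ; avoiding     = avoiding-snoc (∈-++⁺ʳ lows (∈-++⁺ʳ (peakIf e m) (here refl)))
  ; asc≡peak     = trans rising (cong suc asc≡peak)
  ; bounded      = bounded′
  ; onto         = onto′
  ; flat         = asc-snoc-≤ w ∘ flat′
  ; rising       = asc-snoc-< w (n<1+n (suc m))
  ; lows<peak    = All.tabulate (s≤s ∘ below-peak)
  ; lows-unique  = Unique-++⁺ lows-unique (peakIf-unique e m) disjoint
  ; allowed⇒safe = subst (λ A → ∀ {z} → z ∈ A → Safe (w ++ [ suc m ]) z)
                         (sym (allowed-climb m lows e)) safe
  ; safe⇒allowed = λ z≤ safe′ → subst (_ ∈_) (sym (allowed-climb m lows e)) (complete z≤ safe′)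
  }
  where
  open Good g
  bounded′ : All (_≤ suc m) (w ++ [ suc m ])
  bounded′ = ∷ʳ⁺ (All.map m≤n⇒m≤1+n bounded) ≤-refl
  onto′ : ∀ {v} → v ≤ suc m → v ∈ w ++ [ suc m ]
  onto′ v≤1+m with m≤n⇒m<n∨m≡n v≤1+m
  ... | inj₁ v<1+m = ∈-++⁺ˡ (onto (≤-pred v<1+m))
  ... | inj₂ refl  = ∈-++⁺ʳ w (here refl)
  flat′ : ∀ {y} → y ∈ (lows ++ peakIf e m) ++ [ suc m ] → y ≤ suc m
  flat′ y∈ with ∈-++⁻ (lows ++ peakIf e m) y∈
  ... | inj₁ y∈lower   = m≤n⇒m≤1+n (below-peak y∈lower)
  ... | inj₂ (here refl) = ≤-refl
  disjoint : ∀ {v} → ¬ (v ∈ lows × v ∈ peakIf e m)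
  disjoint (v∈lows , v∈peak) = <⇒≢ (All.lookup lows<peak v∈lows) (∈-peakIf⁻ v∈peak)
  safe : ∀ {z} → z ∈ allowed (state m lows e) ++ [ suc (suc m) ] → Safe (w ++ [ suc m ]) z
  safe z∈ with ∈-++⁻ (allowed (state m lows e)) z∈
  ... | inj₁ z∈old       = safe-snoc-max (All.map m≤n⇒m≤1+n bounded) (allowed⇒safe z∈old)
  ... | inj₂ (here refl) = safe-above bounded′
  complete : ∀ {z} → z ≤ suc (suc m) → Safe (w ++ [ suc m ]) z →
             z ∈ allowed (state m lows e) ++ [ suc (suc m) ]
  complete z≤ safe′ with m≤n⇒m<n∨m≡n z≤
  ... | inj₁ z<2+m = ∈-++⁺ˡ (safe⇒allowed (≤-pred z<2+m) (safe-snoc⁻ safe′))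
  ... | inj₂ refl  = ∈-++⁺ʳ _ (here refl)

good-step : ∀ {w s y s′} → Good w s → Step s y s′ → Good (w ++ [ y ]) s′
good-step g (descend y∈lows) = good-descend g y∈lows
good-step g repeat           = good-repeat g
good-step g climb            = good-climb g

children : State → List (ℕ × State)
children (state m lows e) =
  map (λ y → y , state m [ y ] false) lows ++
  map (λ _ → m , state m lows true) (peakIf e m) ++
  [ (suc m , state (suc m) (lows ++ peakIf e m) true) ]

step⇒child : ∀ {s y s′} → Step s y s′ → (y , s′) ∈ children s
step⇒child (descend y∈lows)       = ∈-++⁺ˡ (∈-map⁺ _ y∈lows)
step⇒child {state m lows true} repeat = ∈-++⁺ʳ (map _ lows) (here refl)
step⇒child {state m lows e} climb  = ∈-++⁺ʳ (map _ lows) (∈-++⁺ʳ (map _ (peakIf e m)) (here refl))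

child⇒step : ∀ {s y s′} → (y , s′) ∈ children s → Step s y s′
child⇒step {state m lows e} c∈ with ∈-++⁻ (map _ lows) c∈
... | inj₁ c∈descents with ∈-map⁻ _ c∈descents
...   | _ , y∈lows , refl = descend y∈lows
child⇒step {state m lows e} c∈ | inj₂ c∈rest with ∈-++⁻ (map _ (peakIf e m)) c∈rest
... | inj₁ c∈repeats with e | ∈-map⁻ _ c∈repeats
...   | true | _ , _ , refl = repeat
child⇒step {state m lows e} c∈ | inj₂ c∈rest | inj₂ (here refl) = climb

letters-children : ∀ s → map proj₁ (children s) ≡ allowed s
letters-children (state m lows e) = begin
  map proj₁ (children (state m lows e))
    ≡⟨ trans (map-++ proj₁ (map _ lows) _) (cong (_ ++_) (map-++ proj₁ (map _ (peakIf e m)) _)) ⟩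
  map proj₁ (map _ lows) ++ map proj₁ (map _ (peakIf e m)) ++ [ suc m ]
    ≡⟨ cong₂ _++_ (sym (map-∘ lows)) (cong (_++ [ suc m ]) (repeats e)) ⟩
  map (λ y → y) lows ++ peakIf e m ++ [ suc m ]
    ≡⟨ cong (_++ _) (map-id lows) ⟩
  allowed (state m lows e) ∎
  where
  open ≡-Reasoning
  repeats : ∀ e → map proj₁ (map (λ _ → m , state m lows true) (peakIf e m)) ≡ peakIf e m
  repeats true  = refl
  repeats false = refl

allowed⇒step : ∀ {s y} → y ∈ allowed s → ∃ (Step s y)
allowed⇒step {s} y∈ with ∈-map⁻ proj₁ (subst (_ ∈_) (sym (letters-children s)) y∈)
... | (_ , s′) , c∈ , refl = s′ , child⇒step c∈

safe⇒step : ∀ {w s y} → Good w s → y ≤ suc (asc w) → Safe w y → ∃ (Step s y)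
safe⇒step g y≤ safe = allowed⇒step (safe⇒allowed (subst (λ k → _ ≤ suc k) asc≡peak y≤) safe)
  where open Good g

allowed-unique : ∀ {w s} → Good w s → Unique (allowed s)
allowed-unique {s = state m lows e} g =
  Unique-++⁺ lows-unique (Unique-++⁺ (peakIf-unique e m) ([] ∷ []) peak≢climb) low≢rest
  where
  open Good g
  peak≢climb : ∀ {v} → ¬ (v ∈ peakIf e m × v ∈ [ suc m ])
  peak≢climb (v∈peak , here refl) = 1+n≢n (∈-peakIf⁻ v∈peak)
  low≢rest : ∀ {v} → ¬ (v ∈ lows × v ∈ peakIf e m ++ [ suc m ])
  low≢rest (v∈lows , v∈rest) with ∈-++⁻ (peakIf e m) v∈rest
  ... | inj₁ v∈peak    = <⇒≢ (All.lookup lows<peak v∈lows) (∈-peakIf⁻ v∈peak)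
  ... | inj₂ (here refl) = <⇒≢ (m<n⇒m<1+n (All.lookup lows<peak v∈lows)) refl

-- Enumerating the tree

graft : ∀ {A B : Set} → (B → List (List A)) → List (A × B) → List (List A)
graft g = concatMap (λ (a , b) → map (a ∷_) (g b))

module _ {A B : Set} (g : B → List (List A)) where

  ∈-graft⁻ : ∀ cs {r} → r ∈ graft g cs →
             ∃[ a ] ∃[ b ] ∃[ t ] (a , b) ∈ cs × t ∈ g b × r ≡ a ∷ t
  ∈-graft⁻ ((a , b) ∷ cs) r∈ with ∈-++⁻ (map (a ∷_) (g b)) r∈
  ... | inj₁ r∈head with ∈-map⁻ (a ∷_) r∈head
  ...   | t , t∈ , r≡a∷t = a , b , t , here refl , t∈ , r≡a∷t
  ∈-graft⁻ ((a , b) ∷ cs) r∈ | inj₂ r∈rest with ∈-graft⁻ cs r∈rest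
  ... | a′ , b′ , t , c∈ , t∈ , r≡a′∷t = a′ , b′ , t , there c∈ , t∈ , r≡a′∷t

  ∈-graft⁺ : ∀ cs {a b t} → (a , b) ∈ cs → t ∈ g b → a ∷ t ∈ graft g cs
  ∈-graft⁺ ((a , b) ∷ cs) (here refl) t∈ = ∈-++⁺ˡ (∈-map⁺ (a ∷_) t∈)
  ∈-graft⁺ ((a , b) ∷ cs) (there c∈)  t∈ = ∈-++⁺ʳ (map (a ∷_) (g b)) (∈-graft⁺ cs c∈ t∈)

  graft-unique : ∀ cs → Unique (map proj₁ cs) → All (Unique ∘ g ∘ proj₂) cs → Unique (graft g cs)
  graft-unique []             []          []        = []
  graft-unique ((a , b) ∷ cs) (a∉ ∷ uniq) (gb ∷ gs) =
    Unique-++⁺ (Unique-map⁺ ∷-injectiveʳ gb) (graft-unique cs uniq gs) disjoint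
    where
    disjoint : ∀ {r} → ¬ (r ∈ map (a ∷_) (g b) × r ∈ graft g cs)
    disjoint (r∈head , r∈rest) with ∈-map⁻ (a ∷_) r∈head | ∈-graft⁻ cs r∈rest
    ... | _ , _ , refl | _ , _ , _ , c∈ , _ , refl = All.lookup a∉ (∈-map⁺ proj₁ c∈) refl

  length-graft : ∀ cs → length (graft g cs) ≡ sum (map (length ∘ g ∘ proj₂) cs)
  length-graft []             = refl
  length-graft ((a , b) ∷ cs) =
    trans (length-++ (map (a ∷_) (g b))) (cong₂ _+_ (length-map (a ∷_) (g b)) (length-graft cs))

extensions : ℕ → State → List (List ℕ)
extensions zero    s = [ [] ]
extensions (suc n) s = graft (extensions n) (children s)

data Path : State → List ℕ → State → Set where
  []  : ∀ {s} → Path s [] s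
  _∷_ : ∀ {s y s′ r s″} → Step s y s′ → Path s′ r s″ → Path s (y ∷ r) s″

path-snoc : ∀ {s r s′ y s″} → Path s r s′ → Step s′ y s″ → Path s (r ++ [ y ]) s″
path-snoc []         step = step ∷ []
path-snoc (st ∷ path) step = st ∷ path-snoc path step

good-path : ∀ {w s r s′} → Good w s → Path s r s′ → Good (w ++ r) s′
good-path {w} g [] = subst (λ v → Good v _) (sym (++-identityʳ w)) g
good-path {w} g (_∷_ {y = y} {r = r} step path) =
  subst (λ v → Good v _) (++-assoc w [ y ] r) (good-path (good-step g step) path)

∈-extensions⁻ : ∀ n {s r} → r ∈ extensions n s → length r ≡ n × ∃ (Path s r)
∈-extensions⁻ zero    (here refl) = refl , _ , []
∈-extensions⁻ (suc n) {s} r∈ with ∈-graft⁻ (extensions n) (children s) r∈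
... | _ , _ , t , c∈ , t∈ , refl with ∈-extensions⁻ n t∈
...   | refl , _ , path = refl , _ , child⇒step c∈ ∷ path

∈-extensions⁺ : ∀ {s r s′} → Path s r s′ → r ∈ extensions (length r) s
∈-extensions⁺ []                        = here refl
∈-extensions⁺ {s} (_∷_ {r = r} step path) =
  ∈-graft⁺ (extensions (length r)) (children s) (step⇒child step) (∈-extensions⁺ path)

extensions-unique : ∀ n {w s} → Good w s → Unique (extensions n s)
extensions-unique zero    g = [] ∷ []
extensions-unique (suc n) {s = s} g =
  graft-unique (extensions n) (children s)
    (subst Unique (sym (letters-children s)) (allowed-unique g))
    (All.tabulate (λ c∈ → extensions-unique n (good-step g (child⇒step c∈))))

-- Counting the leaves

leaves     : ℕ → ℕ → Bool → ℕ
peakLeaves : ℕ → ℕ → Bool → ℕ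
leaves zero    t e = 1
leaves (suc n) t e = t * leaves n 1 false + peakLeaves n t e
peakLeaves n t true  = leaves n t true + leaves n (suc t) true
peakLeaves n t false = leaves n t true

sum-map-const : ∀ {A : Set} (f : A → ℕ) {c} → (∀ x → f x ≡ c) → ∀ xs → sum (map f xs) ≡ length xs * c
sum-map-const f f≡c []       = refl
sum-map-const f f≡c (x ∷ xs) = cong₂ _+_ (f≡c x) (sum-map-const f f≡c xs)

length-extensions : ∀ n m lows e → length (extensions n (state m lows e)) ≡ leaves n (length lows) e
length-extensions zero    m lows e = refl
length-extensions (suc n) m lows e = begin
  length (extensions (suc n) (state m lows e))
    ≡⟨ length-graft (extensions n) (children (state m lows e)) ⟩
  sum (map size (descents ++ rest e))
    ≡⟨ trans (cong sum (map-++ size descents (rest e))) (sum-++ (map size descents) _) ⟩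
  sum (map size descents) + sum (map size (rest e))
    ≡⟨ cong₂ _+_ descents-size (rest-size e) ⟩
  leaves (suc n) (length lows) e ∎
  where
  open ≡-Reasoning
  size : ℕ × State → ℕ
  size = length ∘ extensions n ∘ proj₂
  descents : List (ℕ × State)
  descents = map (λ y → y , state m [ y ] false) lows
  rest : Bool → List (ℕ × State)
  rest e = map (λ _ → m , state m lows true) (peakIf e m) ++
           [ (suc m , state (suc m) (lows ++ peakIf e m) true) ]
  descents-size : sum (map size descents) ≡ length lows * leaves n 1 false
  descents-size = trans (cong sum (sym (map-∘ lows)))
                        (sum-map-const _ (λ y → length-extensions n m [ y ] false) lows)
  climb-size : ∀ e {t} → length (lows ++ peakIf e m) ≡ t →
               size (suc m , state (suc m) (lows ++ peakIf e m) true) + 0 ≡ leaves n t true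
  climb-size e refl = trans (+-identityʳ _) (length-extensions n (suc m) (lows ++ peakIf e m) true)
  rest-size : ∀ e → sum (map size (rest e)) ≡ peakLeaves n (length lows) e
  rest-size true  = cong₂ _+_ (length-extensions n m lows true)
                              (climb-size true (trans (length-++ lows) (+-comm _ 1)))
  rest-size false = climb-size false (cong length (++-identityʳ lows))

private
  descent-step : ∀ A B X → 2 * A ≡ X + 1 → 2 * B + 1 ≡ 2 * X + 1 → 2 * (1 * A + B) ≡ 3 * X + 1
  descent-step A B X hA hB = +-cancelʳ-≡ 1 _ _ (begin
    2 * (1 * A + B) + 1     ≡⟨ regroup A B ⟩
    2 * A + (2 * B + 1)     ≡⟨ cong₂ _+_ hA hB ⟩
    (X + 1) + (2 * X + 1)   ≡⟨ collect X ⟩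
    3 * X + 1 + 1           ∎)
    where
    open ≡-Reasoning
    regroup : ∀ A B → 2 * (1 * A + B) + 1 ≡ 2 * A + (2 * B + 1)
    regroup = solve-∀
    collect : ∀ X → (X + 1) + (2 * X + 1) ≡ 3 * X + 1 + 1
    collect = solve-∀

  peak-step : ∀ t A B C X → 2 * A ≡ X + 1 → 2 * B + t ≡ suc t * X + 1 →
              2 * C + suc t ≡ suc (suc t) * X + 1 → 2 * (t * A + (B + C)) + t ≡ suc t * (3 * X) + 1
  peak-step t A B C X hA hB hC = +-cancelʳ-≡ (suc t) _ _ (begin
    2 * (t * A + (B + C)) + t + suc t                      ≡⟨ regroup t A B C ⟩
    t * (2 * A) + (2 * B + t) + (2 * C + suc t)           ≡⟨ cong₂ _+_ (cong₂ _+_ (cong (t *_) hA) hB) hC ⟩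
    t * (X + 1) + (suc t * X + 1) + (suc (suc t) * X + 1) ≡⟨ collect t X ⟩
    suc t * (3 * X) + 1 + suc t                            ∎)
    where
    open ≡-Reasoning
    regroup : ∀ t A B C → 2 * (t * A + (B + C)) + t + suc t ≡ t * (2 * A) + (2 * B + t) + (2 * C + suc t)
    regroup = solve-∀
    collect : ∀ t X → t * (X + 1) + (suc t * X + 1) + (suc (suc t) * X + 1) ≡ suc t * (3 * X) + 1 + suc t
    collect = solve-∀

leaves-descended : ∀ n → 2 * leaves n 1 false ≡ 3 ^ n + 1
leaves-peak      : ∀ n t → 2 * leaves n t true + t ≡ suc t * 3 ^ n + 1
leaves-descended zero    = refl
leaves-descended (suc n) =
  descent-step (leaves n 1 false) (leaves n 1 true) (3 ^ n) (leaves-descended n) (leaves-peak n 1)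
leaves-peak zero    t = base t
  where
  base : ∀ t → 2 * 1 + t ≡ suc t * 1 + 1
  base = solve-∀
leaves-peak (suc n) t =
  peak-step t (leaves n 1 false) (leaves n t true) (leaves n (suc t) true) (3 ^ n)
    (leaves-descended n) (leaves-peak n t) (leaves-peak n (suc t))

reachable : ∀ {x} → IsAscentSeq x → x ≢ [] → Avoiding x →
            ∃[ r ] ∃[ s ] x ≡ 0 ∷ r × Path root r s
reachable nil                 x≢[] _  = ⊥-elim (x≢[] refl)
reachable first               _    _  = [] , root , refl , []
reachable (snoc y asc-w w≢[] y≤) _ av with reachable asc-w w≢[] (Avoiding-++⁻ [ y ] av)
... | r , s , refl , path with safe⇒step (good-path good-root path) y≤ (Avoiding-snoc⇒Safe av)
...   | s′ , step = r ++ [ y ] , s′ , refl , path-snoc path step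

patterns : List (List ℕ)
patterns = (1 ∷ 0 ∷ 1 ∷ []) ∷ (2 ∷ 1 ∷ 0 ∷ []) ∷ []

Avoiding⇔avoids : ∀ {x} → Avoiding x ⇔ All (Avoids x) patterns
Avoiding⇔avoids = mk⇔
  (λ (¬101 , ¬210) → (¬101 ∘ Contains⇒Has101) ∷ (¬210 ∘ Contains⇒Has210) ∷ [])
  (λ { (¬101 ∷ ¬210 ∷ []) → ¬101 ∘ Has101⇒Contains , ¬210 ∘ Has210⇒Contains })

words : ℕ → List (List ℕ)
words n = map (0 ∷_) (extensions n root)

words-unique : ∀ n → Unique (words n)
words-unique n = Unique-map⁺ ∷-injectiveʳ (extensions-unique n good-root)

words-sound : ∀ n {x} → x ∈ words n → InA patterns (suc n) x
words-sound n x∈ with ∈-map⁻ (0 ∷_) x∈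
... | r , r∈ , refl with ∈-extensions⁻ n r∈
...   | len , _ , path = ascending , cong suc len , Equivalence.to Avoiding⇔avoids avoiding
  where open Good (good-path good-root path)

words-complete : ∀ n {x} → InA patterns (suc n) x → x ∈ words n
words-complete n (asc-x , len , avoids)
  with reachable asc-x (λ { refl → 0≢1+n len }) (Equivalence.from Avoiding⇔avoids avoids)
... | r , _ , refl , path =
  ∈-map⁺ (0 ∷_) (subst (λ k → r ∈ extensions k root) (suc-injective len) (∈-extensions⁺ path))

length-words : ∀ n → 2 * length (words n) ≡ 3 ^ n + 1
length-words n = begin
  2 * length (words n)     ≡⟨ cong (2 *_) (trans (length-map (0 ∷_) (extensions n root))
                                                 (length-extensions n 0 [] true)) ⟩
  2 * leaves n 0 true      ≡⟨ sym (+-identityʳ _) ⟩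
  2 * leaves n 0 true + 0  ≡⟨ leaves-peak n 0 ⟩
  1 * 3 ^ n + 1            ≡⟨ cong (_+ 1) (*-identityˡ (3 ^ n)) ⟩
  3 ^ n + 1                ∎
  where open ≡-Reasoning

proposition2p5 : ∀ (n : ℕ) → Σ (List (List ℕ)) λ L →
    Unique L ×
    (∀ x → (x ∈ L) ⇔ InA ((1 ∷ 0 ∷ 1 ∷ []) ∷ (2 ∷ 1 ∷ 0 ∷ []) ∷ []) (suc n) x) ×
    (2 * length L ≡ 3 ^ n + 1)
proposition2p5 n =
  words n , words-unique n , (λ x → mk⇔ (words-sound n) (words-complete n)) , length-words n
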